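{- Let $X$ be a topological space and consider its topological contact algebra $\langle \mathrm{RO}(X),\mathsf{C}_{\mathrm{T}}\rangle$. Then for every abstractive set $A\subseteq \mathrm{RO}(X)$, the set $\bigcap A$ is closed in $X$. Consequently, if $\bigcap A\neq\emptyset$ and $\bigcap A\in \mathrm{RO}(X)$, then $X$ is disconnected.
   Context: $\mathrm{RO}(X)$ is the Boolean algebra of regular open subsets of $X$ with $x\cdot y=x\cap y$, $x+y=\mathrm{Int}\,\mathrm{Cl}(x\cup y)$, $-x=\mathrm{Int}(X\setminus x)$, $\mathsf{0}=\emptyset$, $\mathsf{1}=X$; the contact is $x\mathrel{\mathsf{C}_{\mathrm{T}}} y$ iff $\mathrm{Cl}\,x\cap\mathrm{Cl}\,y\neq\emptyset$. Then $x\ll y$ (defined as $\neg(x\mathrel{\mathsf{C}_{\mathrm{T}}} -y)$) holds iff $\mathrm{Cl}\,x\subseteq y$. An abstractive set is a set $A$ of regions such that (r0) $\emptyset\notin A$; (r1) for all $u,v\in A$: $u=v$ or $u\ll v$ or $v\ll u$; (A) there is no region $x$ (of $\mathrm{RO}(X)$, including possibly $\emptyset$) with $x\subseteq y$ for all $y\in A$ other than... precisely: there is no $x\in\mathrm{RO}(X)$ such that $x\leq y$ for all $y\in A$ — here, as in the paper, the quantifier ranges over non-zero regions, i.e., $A$ has no non-zero lower bound. -}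

module Defs where

import Level
open import Level using (Level; _⊔_) renaming (suc to lsuc)
open import Data.Product using (Σ; _×_; _,_)
open import Data.Sum using (_⊎_)
open import Data.Empty using (⊥)
open import Relation.Nullary using (¬_)

Subset : ∀ {ℓ} → Set ℓ → (ℓ' : Level) → Set (ℓ ⊔ lsuc ℓ')
Subset X ℓ' = X → Set ℓ'

module _ {ℓ : Level} {X : Set ℓ} where
  _⊆_ : ∀ {a b} → Subset X a → Subset X b → Set (ℓ ⊔ a ⊔ b)
  S ⊆ T = ∀ x → S x → T x

  _≐_ : ∀ {a b} → Subset X a → Subset X b → Set (ℓ ⊔ a ⊔ b)
  S ≐ T = (S ⊆ T) × (T ⊆ S)

  ∅ : Subset X Level.zero
  ∅ _ = ⊥

  ∁ : ∀ {a} → Subset X a → Subset X a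
  ∁ S x = ¬ S x

  ⋂ : ∀ {a} → (Subset X ℓ → Set a) → Subset X (lsuc ℓ ⊔ a)
  ⋂ A x = ∀ u → A u → u x

record Topology {ℓ : Level} (X : Set ℓ) : Set (lsuc ℓ) where
  field
    Open  : Set ℓ
    ⟦_⟧   : Open → Subset X ℓ
    ∅-open : Σ Open λ o → ⟦ o ⟧ ≐ ∅ {X = X}
    X-open : Σ Open λ o → ∀ x → ⟦ o ⟧ x
    ∩-open : ∀ o p → Σ Open λ q → ∀ x → (⟦ q ⟧ x → ⟦ o ⟧ x × ⟦ p ⟧ x)
                                           × (⟦ o ⟧ x × ⟦ p ⟧ x → ⟦ q ⟧ x)
    ⋃-open : (I : Set ℓ) (f : I → Open) → Σ Open λ q →
               ∀ x → (⟦ q ⟧ x → Σ I λ i → ⟦ f i ⟧ x)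
                   × (Σ I (λ i → ⟦ f i ⟧ x) → ⟦ q ⟧ x)

module _ {ℓ : Level} {X : Set ℓ} (τ : Topology X) where
  open Topology τ

  IsOpen : ∀ {a} → Subset X a → Set (ℓ ⊔ a)
  IsOpen S = Σ Open λ o → ⟦ o ⟧ ≐ S

  IsClosed : ∀ {a} → Subset X a → Set (ℓ ⊔ a)
  IsClosed S = IsOpen (∁ S)

  Int : ∀ {a} → Subset X a → Subset X (ℓ ⊔ a)
  Int S x = Σ Open λ o → ⟦ o ⟧ x × (⟦ o ⟧ ⊆ S)

  Cl : ∀ {a} → Subset X a → Subset X (ℓ ⊔ a)
  Cl S x = ∀ o → ⟦ o ⟧ x → Σ X λ y → ⟦ o ⟧ y × S y

  IsRegOpen : ∀ {a} → Subset X a → Set (ℓ ⊔ a)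
  IsRegOpen S = Int (Cl S) ≐ S

  NonEmpty : ∀ {a} → Subset X a → Set (ℓ ⊔ a)
  NonEmpty S = ¬ (S ≐ ∅ {X = X})

  -ᴿ_ : ∀ {a} → Subset X a → Subset X (ℓ ⊔ a)
  -ᴿ S = Int (∁ S)

  _C_ : ∀ {a b} → Subset X a → Subset X b → Set (ℓ ⊔ a ⊔ b)
  S C T = Σ X λ z → Cl S z × Cl T z

  _≪_ : ∀ {a b} → Subset X a → Subset X b → Set (ℓ ⊔ a ⊔ b)
  S ≪ T = ¬ (S C (-ᴿ T))

  record Abstractive {a} (A : Subset X ℓ → Set a) : Set (lsuc ℓ ⊔ a) where
    field
      regions : ∀ u → A u → IsRegOpen u
      r0 : ∀ u → A u → NonEmpty u
      r1 : ∀ u v → A u → A v → (u ≐ v) ⊎ (u ≪ v) ⊎ (v ≪ u)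
      noLowerBound : ¬ (Σ (Subset X ℓ) λ x →
                          IsRegOpen x × NonEmpty x × (∀ y → A y → x ⊆ y))

  Disconnected : Set ℓ
  Disconnected = Σ Open λ U → Σ Open λ V →
                   Σ X ⟦ U ⟧ × Σ X ⟦ V ⟧ ×
                   (∀ x → ⟦ U ⟧ x → ⟦ V ⟧ x → ⊥) ×
                   (∀ x → ⟦ U ⟧ x ⊎ ⟦ V ⟧ x)

{-# OPTIONS --safe #-}
-- The complement of ⋂ A is open: if x ∉ u for some u ∈ A, pick v ∈ A with
-- v ≪ u (it exists, since otherwise u would be a non-zero lower bound of A).
-- Then Cl v ⊆ u, so x has a neighbourhood missing v ⊇ ⋂ A.
-- The second half holds vacuously: a non-empty regular open ⋂ A would itself
-- be a non-zero lower bound of A, which condition (A) forbids.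
module Submission where

open import Defs
open import Level using (Level)
open import Data.Product using (_×_; Σ; _,_; proj₁; proj₂)
open import Data.Sum using (inj₁; inj₂)
open import Data.Empty using (⊥-elim)
open import Relation.Nullary using (¬_)
open import Relation.Nullary.Decidable using (True; toWitness; fromWitness)
open import Axiom.ExcludedMiddle using (ExcludedMiddle)
open import Axiom.DoubleNegationElimination using (em⇒dne)

module _ (lem : ∀ {p} → ExcludedMiddle p) where

  dne : ∀ {p} {P : Set p} → ¬ ¬ P → P
  dne = em⇒dne lem

  ¬∀⇒∃¬ : ∀ {a b} {A : Set a} {B : A → Set b} → ¬ (∀ x → B x) → Σ A λ x → ¬ B x
  ¬∀⇒∃¬ ¬∀ = dne λ ¬∃ → ¬∀ λ x → dne λ ¬Bx → ¬∃ (x , ¬Bx)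

  module _ {ℓ : Level} {X : Set ℓ} (τ : Topology X) where
    open Topology τ

    -- The union is indexed by the opens contained in S; membership is
    -- decided by excluded middle so that the index type stays in Set ℓ.
    Int-isOpen : ∀ {b} (S : Subset X b) → IsOpen τ (Int τ S)
    Int-isOpen S = q , (λ x qx → witness x (proj₁ (proj₂ U x) qx))
                     , (λ x (o , ox , o⊆S) → proj₂ (proj₂ U x) ((o , fromWitness o⊆S) , ox))
      where
      Index : Set ℓ
      Index = Σ Open λ o → True (lem {P = ⟦ o ⟧ ⊆ S})
      U = ⋃-open Index proj₁
      q = proj₁ U
      witness : ∀ x → Σ Index (λ i → ⟦ proj₁ i ⟧ x) → Int τ S x
      witness x ((o , o⊆S) , ox) = o , ox , toWitness o⊆S

    ⊆Int⇒IsOpen : ∀ {b} {S : Subset X b} → S ⊆ Int τ S → IsOpen τ S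
    ⊆Int⇒IsOpen S⊆IntS with Int-isOpen _
    ... | o , o⊆IntS , IntS⊆o =
      o , (λ x ox → proj₂ (proj₂ (o⊆IntS x ox)) x (proj₁ (proj₂ (o⊆IntS x ox))))
        , (λ x sx → IntS⊆o x (S⊆IntS x sx))

    IsRegOpen⇒⊆Int : ∀ {b} {S : Subset X b} → IsRegOpen τ S → S ⊆ Int τ S
    IsRegOpen⇒⊆Int (IntClS⊆S , S⊆IntClS) x sx with S⊆IntClS x sx
    ... | o , ox , o⊆ClS = o , ox , λ y oy → IntClS⊆S y (o , oy , o⊆ClS)

    Cl-extensive : ∀ {b} (S : Subset X b) → S ⊆ Cl τ S
    Cl-extensive S z sz o oz = z , oz , sz

    Cl-mono : ∀ {b c} {S : Subset X b} {T : Subset X c} → S ⊆ T → Cl τ S ⊆ Cl τ T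
    Cl-mono S⊆T z clSz o oz with clSz o oz
    ... | y , oy , sy = y , oy , S⊆T y sy

    Int-mono : ∀ {b c} {S : Subset X b} {T : Subset X c} → S ⊆ T → Int τ S ⊆ Int τ T
    Int-mono S⊆T z (o , oz , o⊆S) = o , oz , λ y oy → S⊆T y (o⊆S y oy)

    ∁Cl⊆Int∁ : ∀ {b} (S : Subset X b) → ∁ (Cl τ S) ⊆ Int τ (∁ S)
    ∁Cl⊆Int∁ S z ¬clSz with ¬∀⇒∃¬ ¬clSz
    ... | o , ¬meets with ¬∀⇒∃¬ ¬meets
    ... | oz , ¬∃ = o , oz , λ y oy sy → ¬∃ (y , oy , sy)

    ∁Int⊆Cl∁ : ∀ {b} (S : Subset X b) → ∁ (Int τ S) ⊆ Cl τ (∁ S)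
    ∁Int⊆Cl∁ S z ¬intSz o oz =
      dne λ ¬∃ → ¬intSz (o , oz , λ y oy → dne λ ¬sy → ¬∃ (y , oy , ¬sy))

    ≪⇒Cl⊆ : ∀ {b c} {u : Subset X b} {v : Subset X c} →
            _≪_ τ u v → Int τ (Cl τ v) ⊆ v → Cl τ u ⊆ v
    ≪⇒Cl⊆ {v = v} u≪v IntClv⊆v z clUz = dne λ ¬vz →
      u≪v (z , clUz , Cl-mono (∁Cl⊆Int∁ v) z (∁Int⊆Cl∁ (Cl τ v) z (λ i → ¬vz (IntClv⊆v z i))))

    IsRegOpen-resp-≐ : ∀ {b c} {S : Subset X b} {T : Subset X c} →
                       S ≐ T → IsRegOpen τ S → IsRegOpen τ T
    IsRegOpen-resp-≐ (S⊆T , T⊆S) (IntClS⊆S , S⊆IntClS) =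
        (λ x i → S⊆T x (IntClS⊆S x (Int-mono (Cl-mono T⊆S) x i)))
      , (λ x tx → Int-mono (Cl-mono S⊆T) x (S⊆IntClS x (T⊆S x tx)))

    NonEmpty-resp-≐ : ∀ {b c} {S : Subset X b} {T : Subset X c} →
                      S ≐ T → NonEmpty τ S → NonEmpty τ T
    NonEmpty-resp-≐ (S⊆T , _) neS (T⊆∅ , _) = neS ((λ x sx → T⊆∅ x (S⊆T x sx)) , λ _ ())

    module _ {a} {A : Subset X ℓ → Set a} (abs : Abstractive τ A) where
      open Abstractive abs

      ∃≪-below : ∀ u → A u → Σ (Subset X ℓ) λ v → A v × _≪_ τ v u
      ∃≪-below u au = dne λ ¬∃ → noLowerBound (u , regions u au , r0 u au , u⊆ ¬∃)
        where
        u⊆ : ¬ (Σ (Subset X ℓ) λ v → A v × _≪_ τ v u) → ∀ y → A y → u ⊆ y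
        u⊆ ¬∃ y ay with r1 u y au ay
        ... | inj₁ (u⊆y , _)   = u⊆y
        ... | inj₂ (inj₁ u≪y) = λ z uz → ≪⇒Cl⊆ u≪y (proj₁ (regions y ay)) z (Cl-extensive u z uz)
        ... | inj₂ (inj₂ y≪u) = ⊥-elim (¬∃ (y , ay , y≪u))

      ∁⋂⊆Int∁⋂ : ∁ (⋂ A) ⊆ Int τ (∁ (⋂ A))
      ∁⋂⊆Int∁⋂ x x∉⋂A with ¬∀⇒∃¬ x∉⋂A
      ... | u , ¬[au→ux] with ¬∀⇒∃¬ ¬[au→ux]
      ... | au , ¬ux with ∃≪-below u au
      ... | v , av , v≪u =
        Int-mono (λ y ¬vy y∈⋂A → ¬vy (y∈⋂A v av)) x
          (∁Cl⊆Int∁ v x λ clVx → ¬ux (≪⇒Cl⊆ v≪u (proj₁ (regions u au)) x clVx))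

      ⋂-isClosed : IsClosed τ (⋂ A)
      ⋂-isClosed = ⊆Int⇒IsOpen ∁⋂⊆Int∁⋂

      -- ⋂ A lives in a higher universe than the regions of A, so the lower
      -- bound handed to condition (A) is the open set representing it.
      ⋂-not-nonEmpty-regOpen : NonEmpty τ (⋂ A) → ¬ IsRegOpen τ (⋂ A)
      ⋂-not-nonEmpty-regOpen ne reg with ⊆Int⇒IsOpen (IsRegOpen⇒⊆Int reg)
      ... | o , o⊆⋂A , ⋂A⊆o =
        noLowerBound ( ⟦ o ⟧
                     , IsRegOpen-resp-≐ (⋂A⊆o , o⊆⋂A) reg
                     , NonEmpty-resp-≐ (⋂A⊆o , o⊆⋂A) ne
                     , λ y ay x ox → o⊆⋂A x ox y ay )

lemma3p2 : (lem : ∀ {p} → ExcludedMiddle p) →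
    {ℓ : Level} {X : Set ℓ} (τ : Topology X) →
    ∀ {a} (A : Subset X ℓ → Set a) → Abstractive τ A →
    IsClosed τ (⋂ A) ×
    (NonEmpty τ (⋂ A) → IsRegOpen τ (⋂ A) → Disconnected τ)
lemma3p2 lem τ A abs =
  ⋂-isClosed lem τ abs , λ ne reg → ⊥-elim (⋂-not-nonEmpty-regOpen lem τ abs ne reg)
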